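{- Fix an integer $k\ge 2$ and $\alpha(n)=\omega(1)$, let $d=\alpha(n)\log_2 n$, $p=\left(1-2^{ -2k/\alpha(n)}\right)^{1/k}$, and let $n$ be large enough that $p\le 1/2$. Fix $(s_1,\dots,s_k)\in[n]^k$, let $M\sim k\text{ -OV}_0^\alpha(n)$ and $(U_1,\dots,U_k)=\mathsf{Plant}(M,s_1,\dots,s_k)$. For each coordinate $j\in[d]$, the $k$-bit string $(U_{1,s_1}[j],\dots,U_{k,s_k}[j])$ has distribution $\mathcal{P}_k$ on $\{0,1\}^k$ given by \[ \mathcal{P}_k(x)=p^m(1-p)^{k-m}-(-1)^{k-m}p^k, \] where $m$ is the number of ones in $x$. (Moreover these strings are independent and identically distributed across $j\in[d]$.)
   Context: A $k$-OV instance is a tuple of matrices $U_1,\dots,U_k\in\{0,1\}^{n\times d}$, $U_{\ell,i}$ denoting the $i$-th row of $U_\ell$ and $U_{\ell,i}[j]$ its $j$-th entry. The model distribution $k\text{ -OV}_0^\alpha(n)$ samples all $knd$ entries independently, each equal to $1$ with probability $p$ and $0$ otherwise. The randomized procedure $\mathsf{Plant}(U_1,\dots,U_k,s_1,\dots,s_k)$ does, for each coordinate $j\in[d]$ independently: let $m$ be the number of ones among $U_{1,s_1}[j],\dots,U_{k,s_k}[j]$; if $k-m$ is even, flip $U_{k,s_k}[j]$ with probability $\left(\frac{p}{1-p}\right)^{k-m}$; then return the modified instance. -}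

module Defs where

open import Algebra.Bundles using (CommutativeRing)
open import Data.Nat using (ℕ; zero; suc; _∸_)
open import Data.Fin using (Fin; zero; suc; fromℕ; _≟_)
open import Data.Bool using (Bool; true; false; if_then_else_; _∧_; not; _xor_)
open import Data.List using (List; []; _∷_; [_]; map; concatMap; foldr)
open import Relation.Nullary.Decidable using (⌊_⌋)

bools : List Bool
bools = false ∷ true ∷ []

allFuns : ∀ {a} {A : Set a} → List A → (m : ℕ) → List (Fin m → A)
allFuns xs zero    = [ (λ ()) ]
allFuns xs (suc m) =
  concatMap (λ x → map (λ f → λ { zero → x ; (suc i) → f i }) (allFuns xs m)) xs

eqB : Bool → Bool → Bool
eqB a b = not (a xor b)

allF : (m : ℕ) → (Fin m → Bool) → Bool
allF zero    f = true
allF (suc m) f = f zero ∧ allF m (λ i → f (suc i))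

ones : (m : ℕ) → (Fin m → Bool) → ℕ
ones zero    x = 0
ones (suc m) x = (if x zero then 1 else 0) Data.Nat.+ ones m (λ i → x (suc i))

evenᵇ : ℕ → Bool
evenᵇ zero          = true
evenᵇ (suc zero)    = false
evenᵇ (suc (suc e)) = evenᵇ e

finEq : ∀ {m} → Fin m → Fin m → Bool
finEq i j = ⌊ i ≟ j ⌋

-- A k-OV instance (U_1,…,U_k), U_ℓ ∈ {0,1}^{n×d}:  U ℓ i j = U_{ℓ,i}[j]
Inst : ℕ → ℕ → ℕ → Set
Inst k n d = Fin k → Fin n → Fin d → Bool

allInst : (k n d : ℕ) → List (Inst k n d)
allInst k n d = allFuns (allFuns (allFuns bools d) n) k

module _ {c ℓ} (R : CommutativeRing c ℓ) where
  open CommutativeRing R using (Carrier; _+_; _*_; -_; 0#; 1#)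

  ΣL : ∀ {a} {A : Set a} → List A → (A → Carrier) → Carrier
  ΣL xs f = foldr (λ x acc → f x + acc) 0# xs

  ∏F : (m : ℕ) → (Fin m → Carrier) → Carrier
  ∏F zero    f = 1#
  ∏F (suc m) f = f zero * ∏F m (λ i → f (suc i))

  pow : Carrier → ℕ → Carrier
  pow x zero    = 1#
  pow x (suc e) = x * pow x e

  sub : Carrier → Carrier → Carrier
  sub x y = x + (- y)

  ind : Bool → Carrier
  ind true  = 1#
  ind false = 0#

  -- probability of instance M under k-OV_0^α(n): entries i.i.d. Bernoulli(p)
  μ₀ : (p : Carrier) (k n d : ℕ) → Inst k n d → Carrier
  μ₀ p k n d M =
    ∏F k (λ l → ∏F n (λ i → ∏F d (λ j → if M l i j then p else sub 1# p)))

  -- transition probability Plant(M, s) = U, with flip ratio r = p/(1-p);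
  -- `last` is the index k (the last matrix), only U_{k,s_k}[j] may be flipped.
  plantProb : (r : Carrier) (k n d : ℕ) (last : Fin k) (s : Fin k → Fin n)
              → Inst k n d → Inst k n d → Carrier
  plantProb r k n d last s M U =
    ∏F k (λ l → ∏F n (λ i → ∏F d (λ j →
      if finEq l last ∧ finEq i (s last)
      then entryPlanted j
      else ind (eqB (M l i j) (U l i j)))))
    where
      entryPlanted : Fin d → Carrier
      entryPlanted j =
        let m    = ones k (λ l → M l (s l) j)
            e    = k ∸ m
            same = eqB (M last (s last) j) (U last (s last) j)
        in if evenᵇ e
           then (if same then sub 1# (pow r e) else pow r e)
           else ind same

  block : ∀ {k n d} → (s : Fin k → Fin n) → Inst k n d → Fin d → Fin k → Bool
  block s U j l = U l (s l) j

  -- Pr[ (block of Plant(M,s)) = X ]  for M ~ k-OV_0(n)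
  plantedLaw : (p r : Carrier) (k n d : ℕ) (last : Fin k) (s : Fin k → Fin n)
               → (Fin d → Fin k → Bool) → Carrier
  plantedLaw p r k n d last s X =
    ΣL (allInst k n d) (λ M → ΣL (allInst k n d) (λ U →
      μ₀ p k n d M * plantProb r k n d last s M U
        * ind (allF d (λ j → allF k (λ l → eqB (block s U j l) (X j l))))))

  𝒫 : (p : Carrier) (k : ℕ) → (Fin k → Bool) → Carrier
  𝒫 p k x =
    let m = ones k x in
    sub (pow p m * pow (sub 1# p) (k ∸ m)) (pow (- 1#) (k ∸ m) * pow p k)

{-# OPTIONS --safe #-}
module Submission where

-- Everything factorises over the entries of the instance. Summing out U, every entry off the planted
-- strings contributes 1, so on each coordinate Plant acts on the planted string z of M through a kernel
-- that copies all bits but the k-th one and moves that one; summing out M, the planted strings are i.i.d.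
-- with the product Bernoulli(p) law. For a target string x only the two strings z that agree with x off
-- the k-th bit contribute. Their numbers of zeros differ by one, so exactly one of them has an even number
-- e of zeros and is flipped with probability r^e; since ((1 - p) r)^e = p^e, this changes its contribution
-- by ± p^k whatever e is, which is the correction - (-1)^(k - m) p^k.

open import Defs
open import Algebra.Bundles using (CommutativeRing)
import Algebra.Properties.CommutativeSemigroup as CommutativeSemigroupProperties
import Algebra.Properties.Ring as RingProperties
open import Data.Bool using (Bool; true; false; if_then_else_; _∧_; not; T)
open import Data.Bool.Properties using (if-float; not-involutive; xor-comm)
open import Data.Fin as Fin using (Fin; zero; suc; fromℕ)
open import Data.Fin.Properties using (_≟_)
open import Data.List using (List; []; _∷_; _++_; map; concatMap)
open import Data.Nat as ℕ using (ℕ; zero; suc; _∸_; _≤_; z≤n; s≤s)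
open import Data.Nat.Properties using (m≤n⇒m≤1+n; +-suc; +-∸-assoc; m+[n∸m]≡n)
open import Data.Unit using (tt)
open import Data.Vec.Functional using () renaming (_∷_ to _◂_)
open import Function using (_∘_)
open import Relation.Binary.Core using (_Preserves_⟶_)
open import Relation.Binary.PropositionalEquality as ≡ using (_≡_; _≗_)
open import Relation.Nullary.Decidable using (dec-true; isYes≗does; toWitness; ⌊⌋-map′)
import Relation.Binary.Reasoning.Setoid as SetoidReasoning

finEq-refl : ∀ {m} (t : Fin m) → finEq t t ≡ true
finEq-refl t = ≡.trans (isYes≗does (t ≟ t)) (dec-true (t ≟ t) ≡.refl)

finEq-suc : ∀ {m} (l t : Fin m) → finEq (suc l) (suc t) ≡ finEq l t
finEq-suc l t = ⌊⌋-map′ _ _ (l ≟ t)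

finEq⇒≡ : ∀ {m} {l t : Fin m} → finEq l t ≡ true → l ≡ t
finEq⇒≡ {l = l} {t} eq = toWitness {a? = l ≟ t} (≡.subst T (≡.sym eq) tt)

if-finEq-∧-subst : ∀ {a m m′} {A : Set a} (l t : Fin m) (i u : Fin m′) (h : Fin m → Fin m′ → A) (g : A) →
                   (if finEq l t ∧ finEq i u then h t u else g) ≡ (if finEq l t ∧ finEq i u then h l i else g)
if-finEq-∧-subst l t i u h g with finEq l t in l≡t | finEq i u in i≡u
... | true  | true  = ≡.cong₂ h (≡.sym (finEq⇒≡ l≡t)) (≡.sym (finEq⇒≡ i≡u))
... | true  | false = ≡.refl
... | false | _     = ≡.refl

ones-cong : ∀ m {y z : Fin m → Bool} → y ≗ z → ones m y ≡ ones m z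
ones-cong zero    y≗z = ≡.refl
ones-cong (suc m) y≗z = ≡.cong₂ (λ b o → (if b then 1 else 0) ℕ.+ o) (y≗z zero) (ones-cong m (y≗z ∘ Fin.suc))

ones-≤ : ∀ m (z : Fin m → Bool) → ones m z ≤ m
ones-≤ zero    z = z≤n
ones-≤ (suc m) z with z zero
... | true  = s≤s (ones-≤ m (z ∘ Fin.suc))
... | false = m≤n⇒m≤1+n (ones-≤ m (z ∘ Fin.suc))

_[_]≔_ : ∀ {m} → (Fin m → Bool) → Fin m → Bool → Fin m → Bool
(x [ t ]≔ b) l = if finEq l t then b else x l

≔-at : ∀ {m} (x : Fin m → Bool) t b → (x [ t ]≔ b) t ≡ b
≔-at x t b = ≡.cong (λ c → if c then b else x t) (finEq-refl t)

≔-self : ∀ {m} (x : Fin m → Bool) t → x [ t ]≔ x t ≗ x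
≔-self x t l with finEq l t in l≡t
... | true  = ≡.cong x (≡.sym (finEq⇒≡ l≡t))
... | false = ≡.refl

≔-suc : ∀ {m} (x : Fin (suc m) → Bool) t b → (x [ suc t ]≔ b) ∘ Fin.suc ≗ (x ∘ Fin.suc) [ t ]≔ b
≔-suc x t b i = ≡.cong (λ c → if c then b else x (suc i)) (finEq-suc i t)

ones-≔-true : ∀ m (x : Fin m → Bool) t → ones m (x [ t ]≔ true) ≡ suc (ones m (x [ t ]≔ false))
ones-≔-true (suc m) x zero    = ≡.refl
ones-≔-true (suc m) x (suc t) =
  ≡.trans (≡.cong (x₀ ℕ.+_) (≡.trans (ones-cong m (≔-suc x t true)) (ones-≔-true m (x ∘ Fin.suc) t)))
          (≡.trans (+-suc x₀ _)
                   (≡.cong (λ o → suc (x₀ ℕ.+ o)) (ones-cong m (λ i → ≡.sym (≔-suc x t false i)))))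
  where x₀ = if x zero then 1 else 0

evenᵇ-suc : ∀ e → evenᵇ (suc e) ≡ not (evenᵇ e)
evenᵇ-suc zero          = ≡.refl
evenᵇ-suc (suc zero)    = ≡.refl
evenᵇ-suc (suc (suc e)) = evenᵇ-suc e

evenᵇ-∸-suc : ∀ k o → suc o ≤ k → evenᵇ (k ∸ suc o) ≡ not (evenᵇ (k ∸ o))
evenᵇ-∸-suc (suc k) zero    _         =
  ≡.trans (≡.sym (not-involutive (evenᵇ k))) (≡.cong not (≡.sym (evenᵇ-suc k)))
evenᵇ-∸-suc (suc k) (suc o) (s≤s o<k) = evenᵇ-∸-suc k o o<k

module _ {c ℓ} (R : CommutativeRing c ℓ) where

  open CommutativeRing R hiding (zero)
  open RingProperties ring using (-1*x≈-x; -‿involutive; -‿distribʳ-*)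
  open SetoidReasoning setoid
  private
    module +-CS = CommutativeSemigroupProperties +-commutativeSemigroup
    module *-CS = CommutativeSemigroupProperties *-commutativeSemigroup

  ΣL-cong : ∀ {a} {A : Set a} (xs : List A) {f g : A → Carrier} →
            (∀ x → f x ≈ g x) → ΣL R xs f ≈ ΣL R xs g
  ΣL-cong []       f≈g = refl
  ΣL-cong (x ∷ xs) f≈g = +-cong (f≈g x) (ΣL-cong xs f≈g)

  ΣL-++ : ∀ {a} {A : Set a} (xs ys : List A) (f : A → Carrier) →
          ΣL R (xs ++ ys) f ≈ ΣL R xs f + ΣL R ys f
  ΣL-++ []       ys f = sym (+-identityˡ _)
  ΣL-++ (x ∷ xs) ys f = trans (+-congˡ (ΣL-++ xs ys f)) (sym (+-assoc _ _ _))

  ΣL-map : ∀ {a b} {A : Set a} {B : Set b} (h : A → B) (xs : List A) (f : B → Carrier) →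
           ΣL R (map h xs) f ≈ ΣL R xs (f ∘ h)
  ΣL-map h []       f = refl
  ΣL-map h (x ∷ xs) f = +-congˡ (ΣL-map h xs f)

  ΣL-concatMap : ∀ {a b} {A : Set a} {B : Set b} (h : A → List B) (xs : List A) (f : B → Carrier) →
                 ΣL R (concatMap h xs) f ≈ ΣL R xs (λ x → ΣL R (h x) f)
  ΣL-concatMap h []       f = refl
  ΣL-concatMap h (x ∷ xs) f = trans (ΣL-++ (h x) _ f) (+-congˡ (ΣL-concatMap h xs f))

  *-distribˡ-ΣL : ∀ {a} {A : Set a} (u : Carrier) (xs : List A) (f : A → Carrier) →
                  u * ΣL R xs f ≈ ΣL R xs (λ x → u * f x)
  *-distribˡ-ΣL u []       f = zeroʳ u
  *-distribˡ-ΣL u (x ∷ xs) f = trans (distribˡ u _ _) (+-congˡ (*-distribˡ-ΣL u xs f))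

  *-distribʳ-ΣL : ∀ {a} {A : Set a} (u : Carrier) (xs : List A) (f : A → Carrier) →
                  ΣL R xs f * u ≈ ΣL R xs (λ x → f x * u)
  *-distribʳ-ΣL u []       f = zeroˡ u
  *-distribʳ-ΣL u (x ∷ xs) f = trans (distribʳ u _ _) (+-congˡ (*-distribʳ-ΣL u xs f))

  ΣL-zero : ∀ {a} {A : Set a} (xs : List A) → ΣL R xs (λ _ → 0#) ≈ 0#
  ΣL-zero []       = refl
  ΣL-zero (x ∷ xs) = trans (+-identityˡ _) (ΣL-zero xs)

  ΣL-distrib-+ : ∀ {a} {A : Set a} (xs : List A) (f g : A → Carrier) →
                 ΣL R xs (λ x → f x + g x) ≈ ΣL R xs f + ΣL R xs g
  ΣL-distrib-+ []       f g = sym (+-identityˡ 0#)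
  ΣL-distrib-+ (x ∷ xs) f g = trans (+-congˡ (ΣL-distrib-+ xs f g)) (+-CS.interchange _ _ _ _)

  ΣL-comm : ∀ {a b} {A : Set a} {B : Set b} (xs : List A) (ys : List B) (f : A → B → Carrier) →
            ΣL R xs (λ x → ΣL R ys (f x)) ≈ ΣL R ys (λ y → ΣL R xs (λ x → f x y))
  ΣL-comm []       ys f = sym (ΣL-zero ys)
  ΣL-comm (x ∷ xs) ys f = trans (+-congˡ (ΣL-comm xs ys f)) (sym (ΣL-distrib-+ ys _ _))

  ∏F-cong : ∀ m {f g : Fin m → Carrier} → (∀ i → f i ≈ g i) → ∏F R m f ≈ ∏F R m g
  ∏F-cong zero    f≈g = refl
  ∏F-cong (suc m) f≈g = *-cong (f≈g zero) (∏F-cong m (f≈g ∘ Fin.suc))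

  ∏F-one : ∀ m → ∏F R m (λ _ → 1#) ≈ 1#
  ∏F-one zero    = refl
  ∏F-one (suc m) = trans (*-identityˡ _) (∏F-one m)

  ∏F-distrib-* : ∀ m (f g : Fin m → Carrier) → ∏F R m (λ i → f i * g i) ≈ ∏F R m f * ∏F R m g
  ∏F-distrib-* zero    f g = sym (*-identityˡ 1#)
  ∏F-distrib-* (suc m) f g = trans (*-congˡ (∏F-distrib-* m (f ∘ Fin.suc) (g ∘ Fin.suc))) (*-CS.interchange _ _ _ _)

  ∏F-comm : ∀ m m′ (f : Fin m → Fin m′ → Carrier) →
            ∏F R m (λ i → ∏F R m′ (f i)) ≈ ∏F R m′ (λ j → ∏F R m (λ i → f i j))
  ∏F-comm zero    m′ f = sym (∏F-one m′)
  ∏F-comm (suc m) m′ f = trans (*-congˡ (∏F-comm m m′ (f ∘ Fin.suc))) (sym (∏F-distrib-* m′ _ _))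

  ∏F-if : ∀ m b (g : Fin m → Carrier) → ∏F R m (λ i → if b then g i else 1#) ≈ (if b then ∏F R m g else 1#)
  ∏F-if m true  g = refl
  ∏F-if m false g = ∏F-one m

  ∏F-select : ∀ m (t : Fin m) (a : Fin m → Carrier) → ∏F R m (λ i → if finEq i t then a i else 1#) ≈ a t
  ∏F-select (suc m) zero    a = trans (*-congˡ (∏F-one m)) (*-identityʳ _)
  ∏F-select (suc m) (suc t) a =
    trans (*-identityˡ _)
          (trans (∏F-cong m (λ i → reflexive (≡.cong (λ b → if b then a (suc i) else 1#) (finEq-suc i t))))
                 (∏F-select m t (a ∘ Fin.suc)))

  if-split : ∀ b x y → (if b then x else y) ≈ (if b then x else 1#) * (if b then 1# else y)
  if-split true  x y = sym (*-identityʳ x)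
  if-split false x y = sym (*-identityˡ y)

  ∏F-extract : ∀ m (t : Fin m) (a g : Fin m → Carrier) →
               ∏F R m (λ i → if finEq i t then a i else g i) ≈ a t * ∏F R m (λ i → if finEq i t then 1# else g i)
  ∏F-extract m t a g = begin
      ∏F R m (λ i → if finEq i t then a i else g i)
    ≈⟨ ∏F-cong m (λ i → if-split (finEq i t) (a i) (g i)) ⟩
      ∏F R m (λ i → (if finEq i t then a i else 1#) * (if finEq i t then 1# else g i))
    ≈⟨ ∏F-distrib-* m _ _ ⟩
      ∏F R m (λ i → if finEq i t then a i else 1#) * ∏F R m (λ i → if finEq i t then 1# else g i)
    ≈⟨ *-congʳ (∏F-select m t a) ⟩
      a t * ∏F R m (λ i → if finEq i t then 1# else g i) ∎

  ΣL-allFuns-∏F : ∀ {a} {A : Set a} (xs : List A) m (g : Fin m → A → Carrier) →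
                  ΣL R (allFuns xs m) (λ f → ∏F R m (λ i → g i (f i))) ≈ ∏F R m (λ i → ΣL R xs (g i))
  ΣL-allFuns-∏F xs zero    g = +-identityʳ 1#
  ΣL-allFuns-∏F xs (suc m) g =
    trans (ΣL-concatMap _ xs _)
      (trans (ΣL-cong xs (λ x → trans (ΣL-map _ (allFuns xs m) _)
                                 (trans (sym (*-distribˡ-ΣL (g zero x) (allFuns xs m) _))
                                        (*-congˡ (ΣL-allFuns-∏F xs m (g ∘ Fin.suc))))))
             (sym (*-distribʳ-ΣL _ xs (g zero))))

  ΣL-allFuns-suc : ∀ {a} {A : Set a} (xs : List A) m (G : (Fin (suc m) → A) → Carrier) →
                   G Preserves _≗_ ⟶ _≈_ →
                   ΣL R (allFuns xs (suc m)) G ≈ ΣL R xs (λ x → ΣL R (allFuns xs m) (λ f → G (x ◂ f)))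
  ΣL-allFuns-suc xs m G G-cong =
    trans (ΣL-concatMap _ xs G)
      (ΣL-cong xs (λ x → trans (ΣL-map _ (allFuns xs m) G)
                               (ΣL-cong (allFuns xs m) (λ f → G-cong (λ { zero → ≡.refl ; (suc i) → ≡.refl })))))

  ind-allF : ∀ m (f : Fin m → Bool) → ind R (allF m f) ≈ ∏F R m (ind R ∘ f)
  ind-allF zero    f = refl
  ind-allF (suc m) f with f zero
  ... | true  = trans (ind-allF m (f ∘ Fin.suc)) (sym (*-identityˡ _))
  ... | false = sym (zeroˡ _)

  δ : Bool → Bool → Carrier
  δ a b = ind R (eqB a b)

  δ-comm : ∀ a b → δ a b ≡ δ b a
  δ-comm a b = ≡.cong (ind R ∘ not) (xor-comm a b)

  ΣL-bools-δˡ : ∀ c (G : Bool → Carrier) → ΣL R bools (λ b → δ c b * G b) ≈ G c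
  ΣL-bools-δˡ false G = trans (+-cong (*-identityˡ _) (trans (+-identityʳ _) (zeroˡ _))) (+-identityʳ _)
  ΣL-bools-δˡ true  G = trans (+-cong (zeroˡ _) (trans (+-identityʳ _) (*-identityˡ _))) (+-identityˡ _)

  ΣL-bools-δʳ : ∀ c (G : Bool → Carrier) → ΣL R bools (λ b → G b * δ b c) ≈ G c
  ΣL-bools-δʳ false G = trans (+-cong (*-identityʳ _) (trans (+-identityʳ _) (zeroʳ _))) (+-identityʳ _)
  ΣL-bools-δʳ true  G = trans (+-cong (zeroʳ _) (trans (+-identityʳ _) (*-identityʳ _))) (+-identityˡ _)

  ΣL-allFuns-δ : ∀ m (y : Fin m → Bool) (Ψ : (Fin m → Bool) → Carrier) → Ψ Preserves _≗_ ⟶ _≈_ →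
                 ΣL R (allFuns bools m) (λ z → ∏F R m (λ l → δ (y l) (z l)) * Ψ z) ≈ Ψ y
  ΣL-allFuns-δ zero    y Ψ Ψ-cong = trans (+-identityʳ _) (trans (*-identityˡ _) (Ψ-cong (λ ())))
  ΣL-allFuns-δ (suc m) y Ψ Ψ-cong = begin
      ΣL R (allFuns bools (suc m)) (λ z → ∏F R (suc m) (λ l → δ (y l) (z l)) * Ψ z)
    ≈⟨ ΣL-allFuns-suc bools m (λ z → ∏F R (suc m) (λ l → δ (y l) (z l)) * Ψ z)
         (λ y≗z → *-cong (∏F-cong (suc m) (λ l → reflexive (≡.cong (δ (y l)) (y≗z l)))) (Ψ-cong y≗z)) ⟩
      ΣL R bools (λ b → ΣL R fs (λ f → (δ (y zero) b * Δ f) * Ψ (b ◂ f)))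
    ≈⟨ ΣL-cong bools (λ b → trans (ΣL-cong fs (λ f → *-assoc (δ (y zero) b) (Δ f) (Ψ (b ◂ f))))
                                  (sym (*-distribˡ-ΣL (δ (y zero) b) fs (λ f → Δ f * Ψ (b ◂ f))))) ⟩
      ΣL R bools (λ b → δ (y zero) b * ΣL R fs (λ f → Δ f * Ψ (b ◂ f)))
    ≈⟨ ΣL-bools-δˡ (y zero) (λ b → ΣL R fs (λ f → Δ f * Ψ (b ◂ f))) ⟩
      ΣL R fs (λ f → Δ f * Ψ (y zero ◂ f))
    ≈⟨ ΣL-allFuns-δ m (y ∘ Fin.suc) (λ f → Ψ (y zero ◂ f))
                    (λ f≗g → Ψ-cong (λ { zero → ≡.refl ; (suc l) → f≗g l })) ⟩
      Ψ (y zero ◂ (y ∘ Fin.suc))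
    ≈⟨ Ψ-cong (λ { zero → ≡.refl ; (suc l) → ≡.refl }) ⟩
      Ψ y ∎
    where
    fs = allFuns bools m
    Δ : (Fin m → Bool) → Carrier
    Δ f = ∏F R m (λ l → δ (y (suc l)) (f l))

  -- Inserts 1 = Σ_b δ b (z t) at position t.
  ∏F-δ-except : ∀ m (t : Fin m) (x z : Fin m → Bool) →
                ∏F R m (λ l → if finEq l t then 1# else δ (z l) (x l))
                  ≈ ΣL R bools (λ b → ∏F R m (λ l → δ ((x [ t ]≔ b) l) (z l)))
  ∏F-δ-except m t x z = sym (begin
      ΣL R bools (λ b → ∏F R m (λ l → δ ((x [ t ]≔ b) l) (z l)))
    ≈⟨ ΣL-cong bools (λ b → ∏F-cong m (λ l → reflexive (float b l))) ⟩
      ΣL R bools (λ b → ∏F R m (λ l → if finEq l t then δ b (z l) else δ (z l) (x l)))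
    ≈⟨ ΣL-cong bools (λ b → trans (∏F-extract m t (λ l → δ b (z l)) (λ l → δ (z l) (x l))) (*-comm _ _)) ⟩
      ΣL R bools (λ b → D * δ b (z t))
    ≈⟨ ΣL-bools-δʳ (z t) (λ _ → D) ⟩
      D ∎)
    where
    D = ∏F R m (λ l → if finEq l t then 1# else δ (z l) (x l))
    float : ∀ b l → δ ((x [ t ]≔ b) l) (z l) ≡ (if finEq l t then δ b (z l) else δ (z l) (x l))
    float b l = ≡.trans (if-float (λ c → δ c (z l)) (finEq l t))
                        (≡.cong (λ e → if finEq l t then δ b (z l) else e) (δ-comm (x l) (z l)))

  ΣL-allFuns-δ-except : ∀ m (t : Fin m) (x : Fin m → Bool) (Ψ : (Fin m → Bool) → Carrier) →
                        Ψ Preserves _≗_ ⟶ _≈_ →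
                        ΣL R (allFuns bools m) (λ z → ∏F R m (λ l → if finEq l t then 1# else δ (z l) (x l)) * Ψ z)
                          ≈ ΣL R bools (λ b → Ψ (x [ t ]≔ b))
  ΣL-allFuns-δ-except m t x Ψ Ψ-cong = begin
      ΣL R zs (λ z → ∏F R m (λ l → if finEq l t then 1# else δ (z l) (x l)) * Ψ z)
    ≈⟨ ΣL-cong zs (λ z → trans (*-congʳ (∏F-δ-except m t x z)) (*-distribʳ-ΣL (Ψ z) bools (λ b → Δ b z))) ⟩
      ΣL R zs (λ z → ΣL R bools (λ b → Δ b z * Ψ z))
    ≈⟨ ΣL-comm zs bools (λ z b → Δ b z * Ψ z) ⟩
      ΣL R bools (λ b → ΣL R zs (λ z → Δ b z * Ψ z))
    ≈⟨ ΣL-cong bools (λ b → ΣL-allFuns-δ m (x [ t ]≔ b) Ψ Ψ-cong) ⟩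
      ΣL R bools (λ b → Ψ (x [ t ]≔ b)) ∎
    where
    zs = allFuns bools m
    Δ : Bool → (Fin m → Bool) → Carrier
    Δ b z = ∏F R m (λ l → δ ((x [ t ]≔ b) l) (z l))

  ∏F-δ-expand : ∀ {k d} (g : Fin d → (Fin k → Bool) → Carrier) → (∀ j → g j Preserves _≗_ ⟶ _≈_) →
                ∀ (Y : Fin d → Fin k → Bool) →
                ∏F R d (λ j → g j (Y j))
                  ≈ ΣL R (allFuns (allFuns bools k) d)
                         (λ Z → ∏F R d (λ j → ∏F R k (λ l → δ (Y j l) (Z j l))) * ∏F R d (λ j → g j (Z j)))
  ∏F-δ-expand {k} {d} g g-cong Y = begin
      ∏F R d (λ j → g j (Y j))
    ≈⟨ ∏F-cong d (λ j → sym (ΣL-allFuns-δ k (Y j) (g j) (g-cong j))) ⟩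
      ∏F R d (λ j → ΣL R (allFuns bools k) (λ z → ∏F R k (λ l → δ (Y j l) (z l)) * g j z))
    ≈⟨ sym (ΣL-allFuns-∏F (allFuns bools k) d _) ⟩
      ΣL R (allFuns (allFuns bools k) d) (λ Z → ∏F R d (λ j → ∏F R k (λ l → δ (Y j l) (Z j l)) * g j (Z j)))
    ≈⟨ ΣL-cong (allFuns (allFuns bools k) d) (λ Z → ∏F-distrib-* d _ _) ⟩
      ΣL R (allFuns (allFuns bools k) d)
           (λ Z → ∏F R d (λ j → ∏F R k (λ l → δ (Y j l) (Z j l))) * ∏F R d (λ j → g j (Z j))) ∎

  ∏³ : ∀ {k n d} → (Fin k → Fin n → Fin d → Carrier) → Carrier
  ∏³ {k} {n} {d} F = ∏F R k (λ l → ∏F R n (λ i → ∏F R d (F l i)))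

  ∏³-cong : ∀ {k n d} {F G : Fin k → Fin n → Fin d → Carrier} →
            (∀ l i j → F l i j ≈ G l i j) → ∏³ F ≈ ∏³ G
  ∏³-cong {k} {n} {d} F≈G = ∏F-cong k (λ l → ∏F-cong n (λ i → ∏F-cong d (F≈G l i)))

  ∏³-distrib-* : ∀ {k n d} (F G : Fin k → Fin n → Fin d → Carrier) →
                 ∏³ (λ l i j → F l i j * G l i j) ≈ ∏³ F * ∏³ G
  ∏³-distrib-* {k} {n} {d} F G =
    trans (∏F-cong k (λ l → trans (∏F-cong n (λ i → ∏F-distrib-* d (F l i) (G l i))) (∏F-distrib-* n _ _)))
          (∏F-distrib-* k _ _)

  ΣL-allInst-∏³ : ∀ {k n d} (g : Fin k → Fin n → Fin d → Bool → Carrier) →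
                  ΣL R (allInst k n d) (λ U → ∏³ (λ l i j → g l i j (U l i j)))
                    ≈ ∏³ (λ l i j → ΣL R bools (g l i j))
  ΣL-allInst-∏³ {k} {n} {d} g =
    trans (ΣL-allFuns-∏F _ k _)
          (∏F-cong k (λ l → trans (ΣL-allFuns-∏F _ n _) (∏F-cong n (λ i → ΣL-allFuns-∏F bools d (g l i)))))

  ∏³-block : ∀ {k n d} (s : Fin k → Fin n) (F : Fin k → Fin n → Fin d → Carrier) →
             ∏³ (λ l i j → if finEq i (s l) then F l i j else 1#) ≈ ∏F R d (λ j → ∏F R k (λ l → F l (s l) j))
  ∏³-block {k} {n} {d} s F =
    trans (∏F-cong k (λ l → trans (∏F-cong n (λ i → ∏F-if d (finEq i (s l)) (F l i))) (∏F-select n (s l) _)))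
          (∏F-comm k d _)

  blockIndicator : ∀ {k n d} → (Fin k → Fin n) → Inst k n d → (Fin d → Fin k → Bool) → Carrier
  blockIndicator {k} {n} {d} s U X = ind R (allF d (λ j → allF k (λ l → eqB (block R s U j l) (X j l))))

  blockIndicator-∏³ : ∀ {k n d} (s : Fin k → Fin n) (U : Inst k n d) (X : Fin d → Fin k → Bool) →
                 blockIndicator s U X
                   ≈ ∏³ (λ l i j → if finEq i (s l) then δ (U l i j) (X j l) else 1#)
  blockIndicator-∏³ {k} {n} {d} s U X =
    trans (ind-allF d _) (trans (∏F-cong d (λ j → ind-allF k _)) (sym (∏³-block s (λ l i j → δ (U l i j) (X j l)))))

  pow-cong : ∀ {x y} e → x ≈ y → pow R x e ≈ pow R y e
  pow-cong zero    x≈y = refl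
  pow-cong (suc e) x≈y = *-cong x≈y (pow-cong e x≈y)

  pow-+ : ∀ x u v → pow R x (u ℕ.+ v) ≈ pow R x u * pow R x v
  pow-+ x zero    v = sym (*-identityˡ _)
  pow-+ x (suc u) v = trans (*-congˡ (pow-+ x u v)) (sym (*-assoc _ _ _))

  pow-distrib-* : ∀ x y e → pow R (x * y) e ≈ pow R x e * pow R y e
  pow-distrib-* x y zero    = sym (*-identityˡ 1#)
  pow-distrib-* x y (suc e) = trans (*-congˡ (pow-distrib-* x y e)) (*-CS.interchange _ _ _ _)

  sign : Bool → Carrier
  sign b = if b then 1# else - 1#

  pow-neg-one : ∀ e → pow R (- 1#) e ≈ sign (evenᵇ e)
  pow-neg-one zero          = refl
  pow-neg-one (suc zero)    = *-identityʳ _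
  pow-neg-one (suc (suc e)) =
    trans (trans (-1*x≈-x _) (trans (-‿cong (-1*x≈-x _)) (-‿involutive _))) (pow-neg-one e)

  module Bernoulli (p : Carrier) where

    q : Carrier
    q = sub R 1# p

    bern : Bool → Carrier
    bern b = if b then p else q

    weight : ∀ {m} → (Fin m → Bool) → Carrier
    weight {m} z = ∏F R m (bern ∘ z)

    weight-cong : ∀ {m} → weight {m} Preserves _≗_ ⟶ _≈_
    weight-cong {m} y≗z = ∏F-cong m (λ l → reflexive (≡.cong bern (y≗z l)))

    weight-ones : ∀ m (z : Fin m → Bool) → weight z ≈ pow R p (ones m z) * pow R q (m ∸ ones m z)
    weight-ones zero    z = sym (*-identityˡ 1#)
    weight-ones (suc m) z with z zero
    ... | true  = trans (*-congˡ (weight-ones m (z ∘ Fin.suc))) (sym (*-assoc _ _ _))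
    ... | false = trans (*-congˡ (weight-ones m (z ∘ Fin.suc)))
                   (trans (*-CS.x∙yz≈y∙xz _ _ _)
                          (*-congˡ (reflexive (≡.cong (pow R q) (≡.sym (+-∸-assoc 1 (ones-≤ m (z ∘ Fin.suc))))))))

    ΣL-bern-entry : ∀ c z → ΣL R bools (λ a → bern a * (if c then δ a z else 1#)) ≈ (if c then bern z else 1#)
    ΣL-bern-entry true  z = ΣL-bools-δʳ z bern
    ΣL-bern-entry false z = begin
      q * 1# + (p * 1# + 0#)   ≈⟨ +-cong (*-identityʳ q) (trans (+-identityʳ _) (*-identityʳ p)) ⟩
      (1# + - p) + p           ≈⟨ +-assoc _ _ _ ⟩
      1# + (- p + p)           ≈⟨ +-congˡ (-‿inverseˡ p) ⟩
      1# + 0#                  ≈⟨ +-identityʳ 1# ⟩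
      1#                       ∎

    module _ {k n d : ℕ} (s : Fin k → Fin n) where

      ΣL-μ₀-δ-block : ∀ (Z : Fin d → Fin k → Bool) →
                      ΣL R (allInst k n d)
                           (λ M → μ₀ R p k n d M * ∏F R d (λ j → ∏F R k (λ l → δ (block R s M j l) (Z j l))))
                        ≈ ∏F R d (λ j → weight (Z j))
      ΣL-μ₀-δ-block Z = begin
          ΣL R Is (λ M → μ₀ R p k n d M * ∏F R d (λ j → ∏F R k (λ l → δ (M l (s l) j) (Z j l))))
        ≈⟨ ΣL-cong Is (λ M → trans (*-congˡ (sym (∏³-block s (λ l i j → δ (M l i j) (Z j l)))))
                                   (sym (∏³-distrib-* (λ l i j → bern (M l i j)) (λ l i j → mask l i j (M l i j))))) ⟩
          ΣL R Is (λ M → ∏³ (λ l i j → entry l i j (M l i j)))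
        ≈⟨ ΣL-allInst-∏³ entry ⟩
          ∏³ (λ l i j → ΣL R bools (entry l i j))
        ≈⟨ ∏³-cong (λ l i j → ΣL-bern-entry (finEq i (s l)) (Z j l)) ⟩
          ∏³ (λ l i j → if finEq i (s l) then bern (Z j l) else 1#)
        ≈⟨ ∏³-block s (λ l i j → bern (Z j l)) ⟩
          ∏F R d (λ j → weight (Z j)) ∎
        where
        Is = allInst k n d
        mask : Fin k → Fin n → Fin d → Bool → Carrier
        mask l i j a = if finEq i (s l) then δ a (Z j l) else 1#
        entry : Fin k → Fin n → Fin d → Bool → Carrier
        entry l i j a = bern a * mask l i j a

      ΣL-μ₀-block : ∀ (g : Fin d → (Fin k → Bool) → Carrier) → (∀ j → g j Preserves _≗_ ⟶ _≈_) →
                    ΣL R (allInst k n d) (λ M → μ₀ R p k n d M * ∏F R d (λ j → g j (block R s M j)))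
                      ≈ ∏F R d (λ j → ΣL R (allFuns bools k) (λ z → weight z * g j z))
      ΣL-μ₀-block g g-cong = begin
          ΣL R Is (λ M → μ₀ R p k n d M * G (block R s M))
        ≈⟨ ΣL-cong Is (λ M → trans (*-congˡ (∏F-δ-expand g g-cong (block R s M))) (*-distribˡ-ΣL _ Zs _)) ⟩
          ΣL R Is (λ M → ΣL R Zs (λ Z → μ₀ R p k n d M * (Δ M Z * G Z)))
        ≈⟨ ΣL-cong Is (λ M → ΣL-cong Zs (λ Z → sym (*-assoc _ _ _))) ⟩
          ΣL R Is (λ M → ΣL R Zs (λ Z → (μ₀ R p k n d M * Δ M Z) * G Z))
        ≈⟨ ΣL-comm Is Zs _ ⟩
          ΣL R Zs (λ Z → ΣL R Is (λ M → (μ₀ R p k n d M * Δ M Z) * G Z))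
        ≈⟨ ΣL-cong Zs (λ Z → trans (sym (*-distribʳ-ΣL (G Z) Is _)) (*-congʳ (ΣL-μ₀-δ-block Z))) ⟩
          ΣL R Zs (λ Z → ∏F R d (λ j → weight (Z j)) * G Z)
        ≈⟨ ΣL-cong Zs (λ Z → sym (∏F-distrib-* d _ _)) ⟩
          ΣL R Zs (λ Z → ∏F R d (λ j → weight (Z j) * g j (Z j)))
        ≈⟨ ΣL-allFuns-∏F (allFuns bools k) d (λ j z → weight z * g j z) ⟩
          ∏F R d (λ j → ΣL R (allFuns bools k) (λ z → weight z * g j z)) ∎
        where
        Is = allInst k n d
        Zs = allFuns (allFuns bools k) d
        G : (Fin d → Fin k → Bool) → Carrier
        G Z = ∏F R d (λ j → g j (Z j))
        Δ : Inst k n d → (Fin d → Fin k → Bool) → Carrier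
        Δ M Z = ∏F R d (λ j → ∏F R k (λ l → δ (block R s M j l) (Z j l)))

  module Planting (p r : Carrier) {k n d : ℕ} (L : Fin k) (s : Fin k → Fin n) where

    open Bernoulli p

    -- flipKernel e same: probability that Plant keeps (same = true) or flips the bit at L of a planted
    -- string with e zeros.
    flipKernel : ℕ → Bool → Carrier
    flipKernel e same = if evenᵇ e then (if same then sub R 1# (pow R r e) else pow R r e) else ind R same

    plantKernel : (Fin k → Bool) → Bool → Carrier
    plantKernel z u = flipKernel (k ∸ ones k z) (eqB (z L) u)

    blockKernel : (Fin k → Bool) → (Fin k → Bool) → Carrier
    blockKernel z x = ∏F R k (λ l → if finEq l L then plantKernel z (x l) else δ (z l) (x l))

    plantKernel-cong : ∀ {y z} u → y ≗ z → plantKernel y u ≡ plantKernel z u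
    plantKernel-cong u y≗z = ≡.cong₂ (λ o b → flipKernel (k ∸ o) (eqB b u)) (ones-cong k y≗z) (y≗z L)

    blockKernel-cong : ∀ x → (λ z → blockKernel z x) Preserves _≗_ ⟶ _≈_
    blockKernel-cong x y≗z = ∏F-cong k (λ l → reflexive
      (≡.cong₂ (λ a b → if finEq l L then a else b)
               (plantKernel-cong (x l) y≗z) (≡.cong (λ b → δ b (x l)) (y≗z l))))

    plantProb-∏³ : ∀ M U → plantProb R r k n d L s M U
                             ≈ ∏³ (λ l i j → if finEq l L ∧ finEq i (s L)
                                             then plantKernel (block R s M j) (U l i j) else δ (M l i j) (U l i j))
    plantProb-∏³ M U = ∏³-cong (λ l i j → reflexive
      (if-finEq-∧-subst l L i (s L) (λ l′ i′ → plantKernel (block R s M j) (U l′ i′ j)) _))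

    -- c₁, c₂ and c₃ stand for l = L, i = s L and i = s l.
    ΣL-plant-entry : ∀ c₁ c₂ c₃ a x (E : Bool → Carrier) → (c₁ ≡ true → c₂ ≡ c₃) →
                     ΣL R bools (λ b → (if c₁ ∧ c₂ then E b else δ a b) * (if c₃ then δ b x else 1#))
                       ≈ (if c₃ then (if c₁ then E x else δ a x) else 1#)
    ΣL-plant-entry true  true  true  a x E _ = ΣL-bools-δʳ x E
    ΣL-plant-entry true  false false a x E _ = ΣL-bools-δˡ a (λ _ → 1#)
    ΣL-plant-entry false _     true  a x E _ = ΣL-bools-δʳ x (δ a)
    ΣL-plant-entry false _     false a x E _ = ΣL-bools-δˡ a (λ _ → 1#)
    ΣL-plant-entry true  true  false a x E c₂≡c₃ with () ← c₂≡c₃ ≡.refl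
    ΣL-plant-entry true  false true  a x E c₂≡c₃ with () ← c₂≡c₃ ≡.refl

    ΣL-plantProb-block : ∀ (X : Fin d → Fin k → Bool) (M : Inst k n d) →
                         ΣL R (allInst k n d) (λ U → plantProb R r k n d L s M U * blockIndicator s U X)
                           ≈ ∏F R d (λ j → blockKernel (block R s M j) (X j))
    ΣL-plantProb-block X M = begin
        ΣL R Is (λ U → plantProb R r k n d L s M U * blockIndicator s U X)
      ≈⟨ ΣL-cong Is (λ U → trans (*-cong (plantProb-∏³ M U) (blockIndicator-∏³ s U X))
                                 (sym (∏³-distrib-* (λ l i j → move l i j (U l i j))
                                                    (λ l i j → hit l i j (U l i j))))) ⟩
        ΣL R Is (λ U → ∏³ (λ l i j → entry l i j (U l i j)))
      ≈⟨ ΣL-allInst-∏³ entry ⟩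
        ∏³ (λ l i j → ΣL R bools (entry l i j))
      ≈⟨ ∏³-cong (λ l i j → ΣL-plant-entry (finEq l L) (finEq i (s L)) (finEq i (s l)) (M l i j) (X j l)
                                            (plantKernel (block R s M j))
                                            (λ l≡L → ≡.cong (λ t → finEq i (s t)) (≡.sym (finEq⇒≡ l≡L)))) ⟩
        ∏³ (λ l i j → if finEq i (s l)
                      then (if finEq l L then plantKernel (block R s M j) (X j l) else δ (M l i j) (X j l))
                      else 1#)
      ≈⟨ ∏³-block s (λ l i j → if finEq l L then plantKernel (block R s M j) (X j l) else δ (M l i j) (X j l)) ⟩
        ∏F R d (λ j → blockKernel (block R s M j) (X j)) ∎
      where
      Is = allInst k n d
      move hit entry : Fin k → Fin n → Fin d → Bool → Carrier
      move l i j b = if finEq l L ∧ finEq i (s L) then plantKernel (block R s M j) b else δ (M l i j) b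
      hit l i j b = if finEq i (s l) then δ b (X j l) else 1#
      entry l i j b = move l i j b * hit l i j b

    onesWeight : ℕ → Carrier
    onesWeight o = pow R p o * pow R q (k ∸ o)

    plantedTerm : ℕ → Bool → Carrier
    plantedTerm o same = onesWeight o * flipKernel (k ∸ o) same

    flipKernel-even : ∀ e same → evenᵇ e ≡ true →
                      flipKernel e same ≡ (if same then sub R 1# (pow R r e) else pow R r e)
    flipKernel-even e same ev rewrite ev = ≡.refl

    flipKernel-odd : ∀ e same → evenᵇ e ≡ false → flipKernel e same ≡ ind R same
    flipKernel-odd e same ev rewrite ev = ≡.refl

    pow-balance : r * q ≈ p → ∀ o → o ≤ k → onesWeight o * pow R r (k ∸ o) ≈ pow R p k
    pow-balance rq≈p o o≤k = begin
        pow R p o * pow R q e * pow R r e    ≈⟨ *-assoc _ _ _ ⟩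
        pow R p o * (pow R q e * pow R r e)  ≈⟨ *-congˡ (sym (pow-distrib-* q r e)) ⟩
        pow R p o * pow R (q * r) e          ≈⟨ *-congˡ (pow-cong e (trans (*-comm q r) rq≈p)) ⟩
        pow R p o * pow R p e                ≈⟨ sym (pow-+ p o e) ⟩
        pow R p (o ℕ.+ e)                    ≡⟨ ≡.cong (pow R p) (m+[n∸m]≡n o≤k) ⟩
        pow R p k                            ∎
      where e = k ∸ o

    flip-balance : r * q ≈ p → ∀ o o′ → o ≤ k → o′ ≤ k → evenᵇ (k ∸ o′) ≡ not (evenᵇ (k ∸ o)) →
                   plantedTerm o true + plantedTerm o′ false ≈ onesWeight o + - (sign (evenᵇ (k ∸ o)) * pow R p k)
    flip-balance rq≈p o o′ o≤k o′≤k parity = by-parity (evenᵇ (k ∸ o)) ≡.refl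
      where
      parity′ : ∀ {b} → evenᵇ (k ∸ o) ≡ b → evenᵇ (k ∸ o′) ≡ not b
      parity′ ev = ≡.trans parity (≡.cong not ev)
      by-parity : ∀ b → evenᵇ (k ∸ o) ≡ b →
                  plantedTerm o true + plantedTerm o′ false ≈ onesWeight o + - (sign b * pow R p k)
      by-parity true ev = begin
          onesWeight o * flipKernel (k ∸ o) true + onesWeight o′ * flipKernel (k ∸ o′) false
        ≡⟨ ≡.cong₂ (λ a b → onesWeight o * a + onesWeight o′ * b)
                   (flipKernel-even (k ∸ o) true ev) (flipKernel-odd (k ∸ o′) false (parity′ ev)) ⟩
          onesWeight o * (1# + - pow R r (k ∸ o)) + onesWeight o′ * 0#
        ≈⟨ +-cong (trans (distribˡ _ _ _) (+-cong (*-identityʳ _) (sym (-‿distribʳ-* _ _)))) (zeroʳ _) ⟩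
          (onesWeight o + - (onesWeight o * pow R r (k ∸ o))) + 0#
        ≈⟨ +-identityʳ _ ⟩
          onesWeight o + - (onesWeight o * pow R r (k ∸ o))
        ≈⟨ +-congˡ (-‿cong (trans (pow-balance rq≈p o o≤k) (sym (*-identityˡ _)))) ⟩
          onesWeight o + - (1# * pow R p k) ∎
      by-parity false ev = begin
          onesWeight o * flipKernel (k ∸ o) true + onesWeight o′ * flipKernel (k ∸ o′) false
        ≡⟨ ≡.cong₂ (λ a b → onesWeight o * a + onesWeight o′ * b)
                   (flipKernel-odd (k ∸ o) true ev) (flipKernel-even (k ∸ o′) false (parity′ ev)) ⟩
          onesWeight o * 1# + onesWeight o′ * pow R r (k ∸ o′)
        ≈⟨ +-cong (*-identityʳ _) (pow-balance rq≈p o′ o′≤k) ⟩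
          onesWeight o + pow R p k
        ≈⟨ +-congˡ (sym (trans (-‿cong (-1*x≈-x _)) (-‿involutive _))) ⟩
          onesWeight o + - (- 1# * pow R p k) ∎

    ΣL-planted-bit : r * q ≈ p → ∀ x →
                 ΣL R bools (λ b → weight (x [ L ]≔ b) * plantKernel (x [ L ]≔ b) (x L)) ≈ 𝒫 R p k x
    ΣL-planted-bit rq≈p x = begin
        ΣL R bools (λ b → weight (x [ L ]≔ b) * plantKernel (x [ L ]≔ b) (x L))
      ≈⟨ +-cong (term false) (trans (+-identityʳ _) (term true)) ⟩
        plantedTerm a (eqB false (x L)) + plantedTerm (ones k (x [ L ]≔ true)) (eqB true (x L))
      ≡⟨ ≡.cong (λ o → plantedTerm a (eqB false (x L)) + plantedTerm o (eqB true (x L))) (ones-≔-true k x L) ⟩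
        plantedTerm a (eqB false (x L)) + plantedTerm (suc a) (eqB true (x L))
      ≈⟨ by-planted-bit (x L) (ones-cong k (λ l → ≡.sym (≔-self x L l))) ⟩
        onesWeight (ones k x) + - (sign (evenᵇ (k ∸ ones k x)) * pow R p k)
      ≈⟨ +-congˡ (-‿cong (*-congʳ (sym (pow-neg-one (k ∸ ones k x))))) ⟩
        𝒫 R p k x ∎
      where
      a = ones k (x [ L ]≔ false)
      a≤k : a ≤ k
      a≤k = ones-≤ k (x [ L ]≔ false)
      1+a≤k : suc a ≤ k
      1+a≤k = ≡.subst (_≤ k) (ones-≔-true k x L) (ones-≤ k (x [ L ]≔ true))
      term : ∀ b → weight (x [ L ]≔ b) * plantKernel (x [ L ]≔ b) (x L)
                     ≈ plantedTerm (ones k (x [ L ]≔ b)) (eqB b (x L))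
      term b = *-cong (weight-ones k (x [ L ]≔ b))
                      (reflexive (≡.cong (λ c → flipKernel (k ∸ ones k (x [ L ]≔ b)) (eqB c (x L))) (≔-at x L b)))
      by-planted-bit : ∀ b → ones k x ≡ ones k (x [ L ]≔ b) →
               plantedTerm a (eqB false b) + plantedTerm (suc a) (eqB true b)
                 ≈ onesWeight (ones k x) + - (sign (evenᵇ (k ∸ ones k x)) * pow R p k)
      by-planted-bit false x-ones rewrite x-ones = flip-balance rq≈p a (suc a) a≤k 1+a≤k (evenᵇ-∸-suc k a 1+a≤k)
      by-planted-bit true  x-ones rewrite x-ones | ones-≔-true k x L =
        trans (+-comm _ _)
              (flip-balance rq≈p (suc a) a 1+a≤k a≤k
                 (≡.sym (≡.trans (≡.cong not (evenᵇ-∸-suc k a 1+a≤k)) (not-involutive _))))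

    ΣL-weight-blockKernel : r * q ≈ p → ∀ x →
                            ΣL R (allFuns bools k) (λ z → weight z * blockKernel z x) ≈ 𝒫 R p k x
    ΣL-weight-blockKernel rq≈p x = begin
        ΣL R zs (λ z → weight z * blockKernel z x)
      ≈⟨ ΣL-cong zs (λ z → trans (*-congˡ (∏F-extract k L (λ l → plantKernel z (x l)) (λ l → δ (z l) (x l))))
                                 (*-CS.x∙yz≈z∙xy _ _ _)) ⟩
        ΣL R zs (λ z → ∏F R k (λ l → if finEq l L then 1# else δ (z l) (x l)) * (weight z * plantKernel z (x L)))
      ≈⟨ ΣL-allFuns-δ-except k L x (λ z → weight z * plantKernel z (x L))
           (λ y≗z → *-cong (weight-cong y≗z) (reflexive (plantKernel-cong (x L) y≗z))) ⟩
        ΣL R bools (λ b → weight (x [ L ]≔ b) * plantKernel (x [ L ]≔ b) (x L))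
      ≈⟨ ΣL-planted-bit rq≈p x ⟩
        𝒫 R p k x ∎
      where zs = allFuns bools k

    plantedLaw≈∏𝒫 : r * q ≈ p → ∀ X → plantedLaw R p r k n d L s X ≈ ∏F R d (λ j → 𝒫 R p k (X j))
    plantedLaw≈∏𝒫 rq≈p X = begin
        plantedLaw R p r k n d L s X
      ≈⟨ ΣL-cong Is (λ M → trans (ΣL-cong Is (λ U → *-assoc _ _ _)) (sym (*-distribˡ-ΣL _ Is _))) ⟩
        ΣL R Is (λ M → μ₀ R p k n d M * ΣL R Is (λ U → plantProb R r k n d L s M U * blockIndicator s U X))
      ≈⟨ ΣL-cong Is (λ M → *-congˡ (ΣL-plantProb-block X M)) ⟩
        ΣL R Is (λ M → μ₀ R p k n d M * ∏F R d (λ j → blockKernel (block R s M j) (X j)))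
      ≈⟨ ΣL-μ₀-block s (λ j z → blockKernel z (X j)) (λ j → blockKernel-cong (X j)) ⟩
        ∏F R d (λ j → ΣL R (allFuns bools k) (λ z → weight z * blockKernel z (X j)))
      ≈⟨ ∏F-cong d (λ j → ΣL-weight-blockKernel rq≈p (X j)) ⟩
        ∏F R d (λ j → 𝒫 R p k (X j)) ∎
      where Is = allInst k n d

lemma3 : ∀ {c ℓ} (R : CommutativeRing c ℓ) →
    let open CommutativeRing R in
    (p r : Carrier) → r * sub R 1# p ≈ p →
    (k′ n d : ℕ) → 1 ≤ k′ →
    (s : Fin (suc k′) → Fin n) →
    (X : Fin d → Fin (suc k′) → Bool) →
    plantedLaw R p r (suc k′) n d (fromℕ k′) s X
    ≈ ∏F R d (λ j → 𝒫 R p (suc k′) (X j))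
lemma3 R p r rq≈p k′ n d _ s X = Planting.plantedLaw≈∏𝒫 R p r (fromℕ k′) s rq≈p X
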